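{- Let $G$ be an interval graph with MPQ-tree $\mathcal{T}$, let $(x,y)\in E(G)$ with $x$ over $y$ and $\mathrm{node}(x)\neq\mathrm{node}(y)$. If the $\langle x,y\rangle$-tree-path goes through a central section, then $(x,y)$ is not an interval edge.
   Context: An interval graph is the intersection graph of a finite family of closed intervals on the real line; an edge $(x,y)$ is an interval edge if $G$ with $(x,y)$ removed is an interval graph. MPQ-trees (Korte–Möhring): a rooted ordered tree of P-nodes and Q-nodes encoding $G$. Each vertex is assigned to exactly one node, $\mathrm{node}(v)$. A P-node carries a (possibly empty) set of vertices. A Q-node with children $T_1,\dots,T_k$ carries sections $S_1,\dots,S_k$; each vertex assigned to a Q-node lies in a consecutive run of its sections. For each leaf, the vertices on the root-to-leaf path (P-node sets and, for Q-nodes, the section whose child the path enters) form a maximal clique, each maximal clique arises exactly once, and permuting P-node children and reversing Q-nodes yields exactly the clique orderings in which every vertex is consecutive. $V_i$ is the set of vertices assigned to nodes of $T_i$. The trees considered are those produced by the standard construction and satisfy, for every Q-node with $k$ sections: (a) $V_1,V_k\neq\emptyset$; (b) $S_1\subsetneq S_2$, $S_k\subsetneq S_{k-1}$; (c) $S_{i-1}\cap S_i\neq\emptyset$ for $2\le i\le k$; (d) $S_{i-1}\neq S_i$ for $2\le i\le k$; (e) $(S_i\cap S_{i+1})\setminus S_1\neq\emptyset$ and $(S_{i-1}\cap S_i)\setminus S_k\neq\emptyset$ for $2\le i\le k-1$; (f) $(S_{i-1}\cup V_{i-1})\setminus S_i\neq\emptyset$ and $(S_i\cup V_i)\setminus S_{i-1}\neq\emptyset$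 for $2\le i\le k$. $x$ is over $y$ if $\mathrm{node}(x)$ is the lowest common ancestor of $\mathrm{node}(x)$ and $\mathrm{node}(y)$; the tree path $\mathrm{node}(x)=n_1-\dots-n_t=\mathrm{node}(y)$ is the $\langle x,y\rangle$-tree-path. A section $S_a$ of a Q-node with $k$ sections is central if $1<a<k$. The path goes through a central section if there is a Q-node $n_i$ with $1<i<t$ such that $n_{i+1}$ lies in the subtree of a central section of $n_i$.
   Formalization: Interval graphs and interval edges are defined through families of closed intervals with rational endpoints rather than intervals on the real line. -}

module Defs where

open import Level using (Level)
open import Data.Nat using (ℕ; zero; suc; _<_; _≤_)
open import Data.Fin using (Fin)
open import Data.List using (List; []; _∷_; _++_; map; length; reverse)
open import Data.List.Membership.Propositional using (_∈_)
open import Data.List.Relation.Unary.Any using (Any)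
open import Data.List.Relation.Binary.Permutation.Propositional using (_↭_)
open import Data.List.Relation.Binary.Pointwise using (Pointwise)
open import Data.Product using (Σ; ∃; _×_; _,_; proj₁)
open import Data.Sum using (_⊎_)
open import Data.Rational as ℚ using (ℚ)
open import Relation.Binary.PropositionalEquality using (_≡_; _≢_)
open import Relation.Nullary using (¬_)
open import Function.Bundles using (_⇔_)

record Graph (n : ℕ) : Set₁ where
  field
    Adj    : Fin n → Fin n → Set
    sym    : ∀ {u v} → Adj u v → Adj v u
    irrefl : ∀ {u} → ¬ Adj u u
open Graph public

IsIntervalRel : ∀ {n} → (Fin n → Fin n → Set) → Set
IsIntervalRel {n} R =
  Σ (Fin n → ℚ) λ l → Σ (Fin n → ℚ) λ r →
    (∀ v → l v ℚ.≤ r v) ×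
    (∀ u v → u ≢ v → R u v ⇔ (l u ℚ.≤ r v × l v ℚ.≤ r u))

IsIntervalGraph : ∀ {n} → Graph n → Set
IsIntervalGraph G = IsIntervalRel (Adj G)

removeEdge : ∀ {n} → Graph n → Fin n → Fin n → Fin n → Fin n → Set
removeEdge G x y u v =
  Adj G u v × ¬ ((u ≡ x × v ≡ y) ⊎ (u ≡ y × v ≡ x))

IsIntervalEdge : ∀ {n} → Graph n → Fin n → Fin n → Set
IsIntervalEdge G x y = IsIntervalRel (removeEdge G x y)

IsClique : ∀ {n} → Graph n → (Fin n → Set) → Set
IsClique G C = ∀ u v → C u → C v → u ≢ v → Adj G u v

IsMaximalClique : ∀ {n} → Graph n → (Fin n → Set) → Set
IsMaximalClique {n} G C =
  IsClique G C × (∀ w → (∀ u → C u → u ≢ w → Adj G u w) → C w)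

SameSet : ∀ {n} → (Fin n → Set) → (Fin n → Set) → Set
SameSet C D = ∀ v → C v ⇔ D v

data Nth {a} {A : Set a} : List A → ℕ → A → Set a where
  nz : ∀ {x xs} → Nth (x ∷ xs) zero x
  ns : ∀ {x y xs i} → Nth xs i y → Nth (x ∷ xs) (suc i) y

-- A P-node carries a set of vertices and an ordered list of children;
-- a Q-node carries its sections S_1..S_k, each paired with its child T_i.

data MPQ (n : ℕ) : Set where
  pnode : List (Fin n) → List (MPQ n) → MPQ n
  qnode : List (List (Fin n) × MPQ n) → MPQ n

Addr : Set
Addr = List ℕ

IsPrefix : Addr → Addr → Set
IsPrefix a b = Σ Addr λ p → b ≡ a ++ p

module _ {n : ℕ} where

  data ChildAt : MPQ n → ℕ → MPQ n → Set where
    pc : ∀ {vs cs i c} → Nth cs i c → ChildAt (pnode vs cs) i c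
    qc : ∀ {ss i S c} → Nth ss i (S , c) → ChildAt (qnode ss) i c

  data SubtreeAt : MPQ n → Addr → MPQ n → Set where
    here  : ∀ {t} → SubtreeAt t [] t
    there : ∀ {t i c a s} → ChildAt t i c → SubtreeAt c a s →
            SubtreeAt t (i ∷ a) s

  Carries : MPQ n → Fin n → Set
  Carries (pnode vs cs) v = v ∈ vs
  Carries (qnode ss)    v = Any (λ p → v ∈ proj₁ p) ss

  NodeOf : MPQ n → Fin n → Addr → Set
  NodeOf T v a = Σ (MPQ n) λ s → SubtreeAt T a s × Carries s v

  VertsIn : MPQ n → Fin n → Set
  VertsIn t v = Σ Addr λ a → NodeOf t v a

  NoChildren : MPQ n → Set
  NoChildren (pnode vs cs) = cs ≡ []
  NoChildren (qnode ss)    = ss ≡ []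

  IsLeafAddr : MPQ n → Addr → Set
  IsLeafAddr T a = Σ (MPQ n) λ s → SubtreeAt T a s × NoChildren s

  -- OnPath T a v : v belongs to the vertex set of the root-to-a path
  -- (P-node sets, and for Q-nodes the section whose child the path enters)
  data OnPath : MPQ n → Addr → Fin n → Set where
    atP    : ∀ {vs cs a v} → v ∈ vs → OnPath (pnode vs cs) a v
    belowP : ∀ {vs cs i c a v} → Nth cs i c → OnPath c a v →
             OnPath (pnode vs cs) (i ∷ a) v
    atQ    : ∀ {ss i S c a v} → Nth ss i (S , c) → v ∈ S →
             OnPath (qnode ss) (i ∷ a) v
    belowQ : ∀ {ss i S c a v} → Nth ss i (S , c) → OnPath c a v →
             OnPath (qnode ss) (i ∷ a) v

  mutual
    leaves : MPQ n → List Addr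
    leaves (pnode vs []) = [] ∷ []
    leaves (pnode vs (c ∷ cs)) = leavesP 0 (c ∷ cs)
    leaves (qnode []) = [] ∷ []
    leaves (qnode (s ∷ ss)) = leavesQ 0 (s ∷ ss)

    leavesP : ℕ → List (MPQ n) → List Addr
    leavesP i [] = []
    leavesP i (c ∷ cs) = map (i ∷_) (leaves c) ++ leavesP (suc i) cs

    leavesQ : ℕ → List (List (Fin n) × MPQ n) → List Addr
    leavesQ i [] = []
    leavesQ i ((S , c) ∷ ss) = map (i ∷_) (leaves c) ++ leavesQ (suc i) ss

  mutual
    data Equiv : MPQ n → MPQ n → Set where
      pe : ∀ {vs cs ds es} → EquivL cs ds → ds ↭ es →
           Equiv (pnode vs cs) (pnode vs es)
      qe : ∀ {ss ts} → EquivS ss ts → Equiv (qnode ss) (qnode ts)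
      qr : ∀ {ss ts} → EquivS ss ts → Equiv (qnode ss) (qnode (reverse ts))

    data EquivL : List (MPQ n) → List (MPQ n) → Set where
      []  : EquivL [] []
      _∷_ : ∀ {c d cs ds} → Equiv c d → EquivL cs ds → EquivL (c ∷ cs) (d ∷ ds)

    data EquivS : List (List (Fin n) × MPQ n) → List (List (Fin n) × MPQ n) → Set where
      []  : EquivS [] []
      _∷_ : ∀ {S c d ss ts} → Equiv c d → EquivS ss ts →
            EquivS ((S , c) ∷ ss) ((S , d) ∷ ts)

  IsConsecutiveCliqueOrdering : Graph n → List (Fin n → Set) → Set₁
  IsConsecutiveCliqueOrdering G Cs =
    (∀ i C → Nth Cs i C → IsMaximalClique G C) ×
    (∀ C → IsMaximalClique G C → Σ ℕ λ i → Σ (Fin n → Set) λ D → Nth Cs i D × SameSet C D) ×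
    (∀ i j C D → Nth Cs i C → Nth Cs j D → SameSet C D → i ≡ j) ×
    (∀ v i j l Ci Cj Cl → Nth Cs i Ci → Nth Cs l Cl → Nth Cs j Cj →
       i ≤ l → l ≤ j → Ci v → Cj v → Cl v)

  -- conditions (a)-(f) for a Q-node with sections ss = (S_1,T_1) … (S_k,T_k)
  -- (0-based indices; S₁ is the first, Sk the last section)
  Subsetneq : List (Fin n) → List (Fin n) → Set
  Subsetneq A B = (∀ v → v ∈ A → v ∈ B) × Σ (Fin n) λ v → v ∈ B × ¬ (v ∈ A)

  QNodeConditions : List (List (Fin n) × MPQ n) → Set
  QNodeConditions ss =
    Σ (List (Fin n)) λ S₁ → Σ (MPQ n) λ T₁ →
    Σ (List (Fin n)) λ Sk → Σ (MPQ n) λ Tk →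
    Σ ℕ λ k → suc k ≡ length ss × Nth ss 0 (S₁ , T₁) × Nth ss k (Sk , Tk) ×
    Σ (Fin n) (VertsIn T₁) × Σ (Fin n) (VertsIn Tk) ×
    (∀ S₂ T₂ → Nth ss 1 (S₂ , T₂) → Subsetneq S₁ S₂) ×
    (∀ k' S T → suc k' ≡ k → Nth ss k' (S , T) → Subsetneq Sk S) ×
    (∀ i A TA B TB → Nth ss i (A , TA) → Nth ss (suc i) (B , TB) →
       (Σ (Fin n) λ v → v ∈ A × v ∈ B) ×
       ¬ (∀ v → (v ∈ A) ⇔ (v ∈ B)) ×
       (Σ (Fin n) λ v → (v ∈ A ⊎ VertsIn TA v) × ¬ (v ∈ B)) ×
       (Σ (Fin n) λ v → (v ∈ B ⊎ VertsIn TB v) × ¬ (v ∈ A))) ×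
    (∀ i A TA B TB C TC → Nth ss i (A , TA) → Nth ss (suc i) (B , TB) →
       Nth ss (suc (suc i)) (C , TC) →
       (Σ (Fin n) λ v → v ∈ B × v ∈ C × ¬ (v ∈ S₁)) ×
       (Σ (Fin n) λ v → v ∈ A × v ∈ B × ¬ (v ∈ Sk)))

  IsMPQTree : Graph n → MPQ n → Set₁
  IsMPQTree G T =
    (∀ v → Σ Addr (NodeOf T v)) ×
    (∀ v a b → NodeOf T v a → NodeOf T v b → a ≡ b) ×
    (∀ a ss → SubtreeAt T a (qnode ss) →
       ∀ v i j l Si Ti Sj Tj Sl Tl → Nth ss i (Si , Ti) → Nth ss l (Sl , Tl) →
       Nth ss j (Sj , Tj) → i ≤ l → l ≤ j → v ∈ Si → v ∈ Sj → v ∈ Sl) ×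
    (∀ a → IsLeafAddr T a → IsMaximalClique G (OnPath T a)) ×
    (∀ C → IsMaximalClique G C →
       Σ Addr λ a → IsLeafAddr T a × SameSet C (OnPath T a)) ×
    (∀ a b → IsLeafAddr T a → IsLeafAddr T b →
       SameSet (OnPath T a) (OnPath T b) → a ≡ b) ×
    (∀ Cs → IsConsecutiveCliqueOrdering G Cs ⇔
       (Σ (MPQ n) λ T' → Equiv T T' ×
          Pointwise (λ C a → SameSet C (OnPath T' a)) Cs (leaves T'))) ×
    (∀ a ss → SubtreeAt T a (qnode ss) → QNodeConditions ss)


  IsOver : MPQ n → Fin n → Fin n → Set
  IsOver T x y = Σ Addr λ ax → Σ Addr λ ay →
    NodeOf T x ax × NodeOf T y ay × IsPrefix ax ay

  -- the tree path from address ax down to address ay goes through a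
  -- central section: some Q-node n_i (1 < i < t) on it, whose next node
  -- n_{i+1} lies in the subtree of a central section (0-based index j, 0<j<k-1)
  ThroughCentral : MPQ n → Addr → Addr → Set
  ThroughCentral T ax ay =
    Σ Addr λ q → Σ ℕ λ j → Σ Addr λ r → Σ (List (List (Fin n) × MPQ n)) λ ss →
      ay ≡ ax ++ (q ++ (j ∷ r)) × q ≢ [] ×
      SubtreeAt T (ax ++ q) (qnode ss) × 0 < j × suc j < length ss

-- Let the tree path leave node(x) and reach a Q-node with sections S₁ … Sₖ strictly below it,
-- entering the central section Sⱼ towards y; pick a ∈ V₁ and b ∈ Vₖ. Since x lies on
-- every root-to-leaf path through that Q-node, x is adjacent to a, to b and to every vertex at
-- or below the Q-node. Condition (e) chains Sⱼ to Sₖ through vertices outside S₁, and to S₁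
-- through vertices outside Sₖ, giving walks y ⇝ b avoiding N[a] and y ⇝ a avoiding N[b] that
-- never use x. In an interval model of G − xy the interval of x still meets the disjoint
-- intervals of a and b but not that of y, so y lies beyond a or beyond b, and the walk that must
-- avoid that vertex would have to cross its interval.

module Submission where

open import Defs
open import Data.Nat as ℕ using (ℕ; zero; suc; _+_; z≤n; s≤s)
import Data.Nat.Properties as ℕ
open import Data.Fin using (Fin)
open import Data.Fin.Properties using (_≟_)
open import Data.List using (List; []; _∷_; _++_; length; filter; allFin)
open import Data.List.Properties using (∷-injectiveˡ; ++-assoc; ++-cancelˡ; ++-identityʳ-unique)
open import Data.List.Membership.Propositional using (_∈_)
open import Data.List.Membership.Propositional.Properties using (∈-allFin; ∈-filter⁺; ∈-filter⁻)
import Data.List.Relation.Unary.All as All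
open import Data.List.Relation.Unary.Any using (Any; here; there)
open import Data.Rational using (ℚ; _≤_; _<_)
open import Data.Rational.Properties
  using (≤-refl; ≤-trans; <-trans; <-≤-trans; <-irrefl; _≤?_; ≰⇒>; ≤-total; ≤-decTotalOrder)
open import Relation.Binary.Bundles using (DecTotalOrder)
open import Data.Product using (Σ; ∃; ∃₂; _×_; _,_; proj₁; proj₂)
open import Data.Sum using (_⊎_; inj₁; inj₂)
open import Data.Empty using (⊥; ⊥-elim)
open import Function.Bundles using (_⇔_; Equivalence)
open import Relation.Binary.PropositionalEquality using (_≡_; _≢_; refl; cong; subst; trans) renaming (sym to ≡-sym)
open import Relation.Binary.Construct.Closure.ReflexiveTransitive using (Star; ε; _◅_)
open import Relation.Nullary using (¬_; Dec; yes; no)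

open Equivalence using (to; from)

module _ {a} {A : Set a} where

  Nth-functional : ∀ {xs i} {x y : A} → Nth xs i x → Nth xs i y → x ≡ y
  Nth-functional nz     nz     = refl
  Nth-functional (ns p) (ns q) = Nth-functional p q

  Nth-total : ∀ (xs : List A) {i} → i ℕ.< length xs → ∃ (Nth xs i)
  Nth-total (x ∷ xs) {zero}  _         = x , nz
  Nth-total (x ∷ xs) {suc i} (s≤s i<n) = let y , p = Nth-total xs i<n in y , ns p

  Nth⇒Any : ∀ {p} {P : A → Set p} {xs i x} → Nth xs i x → P x → Any P xs
  Nth⇒Any nz     px = here px
  Nth⇒Any (ns p) px = there (Nth⇒Any p px)

  Any⇒Nth : ∀ {p} {P : A → Set p} {xs} → Any P xs → ∃₂ λ i x → Nth xs i x × P x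
  Any⇒Nth (here px) = zero , _ , nz , px
  Any⇒Nth (there pxs) = let i , x , p , px = Any⇒Nth pxs in suc i , x , ns p , px

module _ {n : ℕ} where

  ChildAt-functional : ∀ {t : MPQ n} {i c d} → ChildAt t i c → ChildAt t i d → c ≡ d
  ChildAt-functional (pc p) (pc q) = Nth-functional p q
  ChildAt-functional (qc p) (qc q) = cong proj₂ (Nth-functional p q)

  SubtreeAt-functional : ∀ {t : MPQ n} {a s u} → SubtreeAt t a s → SubtreeAt t a u → s ≡ u
  SubtreeAt-functional here here = refl
  SubtreeAt-functional (there c p) (there d q) with ChildAt-functional c d
  ... | refl = SubtreeAt-functional p q

  SubtreeAt-++ : ∀ {t : MPQ n} {a b s u} → SubtreeAt t a s → SubtreeAt s b u → SubtreeAt t (a ++ b) u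
  SubtreeAt-++ here        q = q
  SubtreeAt-++ (there c p) q = there c (SubtreeAt-++ p q)

  NodeOf-child : ∀ {t : MPQ n} {a s i c v z} → SubtreeAt t a s → ChildAt s i c → NodeOf c v z →
                 NodeOf t v (a ++ i ∷ z)
  NodeOf-child st ch (u , cu , m) = u , SubtreeAt-++ st (there ch cu) , m

  IsLeafAddr-++ : ∀ {t : MPQ n} {a s e} → SubtreeAt t a s → IsLeafAddr s e → IsLeafAddr t (a ++ e)
  IsLeafAddr-++ st (u , su , leaf) = u , SubtreeAt-++ st su , leaf

  leaf-below : ∀ (s : MPQ n) → ∃ (IsLeafAddr s)
  leaf-below (pnode vs []) = [] , _ , here , refl
  leaf-below (pnode vs (c ∷ cs)) =
    let e , u , st , leaf = leaf-below c in zero ∷ e , u , there (pc nz) st , leaf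
  leaf-below (qnode []) = [] , _ , here , refl
  leaf-below (qnode ((S , c) ∷ ss)) =
    let e , u , st , leaf = leaf-below c in zero ∷ e , u , there (qc nz) st , leaf

  Contributes : MPQ n → Addr → Fin n → Set
  Contributes (pnode vs cs) _       v = v ∈ vs
  Contributes (qnode ss)    []      v = ⊥
  Contributes (qnode ss)    (i ∷ _) v = ∃₂ λ S c → Nth ss i (S , c) × v ∈ S

  Contributes⇒Carries : ∀ s {a v} → Contributes s a v → Carries s v
  Contributes⇒Carries (pnode vs cs) v∈vs = v∈vs
  Contributes⇒Carries (qnode ss) {i ∷ _} (S , c , p , v∈S) = Nth⇒Any p v∈S

  Contributes-head : ∀ (s : MPQ n) {i a b v} → Contributes s (i ∷ a) v → Contributes s (i ∷ b) v
  Contributes-head (pnode vs cs) m = m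
  Contributes-head (qnode ss)    m = m

  contributes⇒OnPath : ∀ {t a s b v} → SubtreeAt t a s → Contributes s b v → OnPath t (a ++ b) v
  contributes⇒OnPath {s = pnode _ _} here v∈vs = atP v∈vs
  contributes⇒OnPath {s = qnode _} {b = _ ∷ _} here (S , c , p , v∈S) = atQ p v∈S
  contributes⇒OnPath (there (pc p) st) m = belowP p (contributes⇒OnPath st m)
  contributes⇒OnPath (there (qc p) st) m = belowQ p (contributes⇒OnPath st m)

  OnPath⇒contributes : ∀ {t L v} → OnPath t L v →
                       ∃₂ λ a b → L ≡ a ++ b × ∃ λ s → SubtreeAt t a s × Contributes s b v
  OnPath⇒contributes (atP v∈vs) = [] , _ , refl , _ , here , v∈vs
  OnPath⇒contributes (atQ p v∈S) = [] , _ , refl , _ , here , (_ , _ , p , v∈S)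
  OnPath⇒contributes (belowP {i = i} p path) =
    let a , b , L≡ , s , st , m = OnPath⇒contributes path in i ∷ a , b , cong (i ∷_) L≡ , s , there (pc p) st , m
  OnPath⇒contributes (belowQ {i = i} p path) =
    let a , b , L≡ , s , st , m = OnPath⇒contributes path in i ∷ a , b , cong (i ∷_) L≡ , s , there (qc p) st , m

  contributing-leaf : ∀ (s : MPQ n) {v} → Carries s v → ∃ λ e → IsLeafAddr s e × Contributes s e v
  contributing-leaf (pnode vs cs) v∈vs = let e , leaf = leaf-below (pnode vs cs) in e , leaf , v∈vs
  contributing-leaf (qnode ss) v∈ss with Any⇒Nth v∈ss
  ... | i , (S , c) , p , v∈S = let e , u , su , leaf = leaf-below c in
    i ∷ e , (u , there (qc p) su , leaf) , (S , c , p , v∈S)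

  node-onLeaf : ∀ {t : MPQ n} {v av} → NodeOf t v av → ∃ λ e → IsLeafAddr t (av ++ e) × OnPath t (av ++ e) v
  node-onLeaf (s , st , v∈s) =
    let e , leaf , m = contributing-leaf s v∈s in e , IsLeafAddr-++ st leaf , contributes⇒OnPath st m

module IntervalModel {n : ℕ} (R : Fin n → Fin n → Set) (l r : Fin n → ℚ)
  (valid : ∀ v → l v ≤ r v)
  (model : ∀ u v → u ≢ v → R u v ⇔ (l u ≤ r v × l v ≤ r u)) where

  Apart : Fin n → Fin n → Set
  Apart u v = ¬ (u ≡ v ⊎ R u v)

  infix 4 _◁_

  _◁_ : Fin n → Fin n → Set
  u ◁ v = r u < l v

  R⇒overlap : ∀ {u v} → R u v → l u ≤ r v × l v ≤ r u
  R⇒overlap {u} {v} ruv with u ≟ v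
  ... | yes refl = valid u , valid u
  ... | no u≢v   = to (model u v u≢v) ruv

  ◁-trans : ∀ {u v w} → u ◁ v → v ◁ w → u ◁ w
  ◁-trans {v = v} u◁v v◁w = <-trans (<-≤-trans u◁v (valid v)) v◁w

  ◁⇒¬touch : ∀ {u v} → u ◁ v → ¬ (l v ≤ r u)
  ◁⇒¬touch u◁v lv≤ru = <-irrefl refl (<-≤-trans u◁v lv≤ru)

  ◁-asym : ∀ {u v} → u ◁ v → ¬ (v ◁ u)
  ◁-asym {u} u◁v v◁u = ◁⇒¬touch (◁-trans u◁v v◁u) (valid u)

  apart⇒◁⊎▷ : ∀ {u v} → Apart u v → u ◁ v ⊎ v ◁ u
  apart⇒◁⊎▷ {u} {v} u#v with l u ≤? r v | l v ≤? r u
  ... | no lu≰rv | _        = inj₂ (≰⇒> lu≰rv)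
  ... | yes _    | no lv≰ru = inj₁ (≰⇒> lv≰ru)
  ... | yes lu≤rv | yes lv≤ru =
    ⊥-elim (u#v (inj₂ (from (model u v (λ u≡v → u#v (inj₁ u≡v))) (lu≤rv , lv≤ru))))

  Step : Fin n → Fin n → Fin n → Set
  Step c u v = (u ≡ v ⊎ R u v) × Apart v c

  Walk : Fin n → Fin n → Fin n → Set
  Walk c = Star (Step c)

  walk-◁ : ∀ {c u w} → Walk c u w → u ◁ c → w ◁ c
  walk-◁ ε u◁c = u◁c
  walk-◁ ((inj₁ refl , _) ◅ walk) u◁c = walk-◁ walk u◁c
  walk-◁ ((inj₂ ruv , v#c) ◅ walk) u◁c with apart⇒◁⊎▷ v#c
  ... | inj₁ v◁c = walk-◁ walk v◁c
  ... | inj₂ c◁v = ⊥-elim (◁⇒¬touch (◁-trans u◁c c◁v) (proj₂ (R⇒overlap ruv)))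

  walk-▷ : ∀ {c u w} → Walk c u w → c ◁ u → c ◁ w
  walk-▷ ε c◁u = c◁u
  walk-▷ ((inj₁ refl , _) ◅ walk) c◁u = walk-▷ walk c◁u
  walk-▷ ((inj₂ ruv , v#c) ◅ walk) c◁u with apart⇒◁⊎▷ v#c
  ... | inj₂ c◁v = walk-▷ walk c◁v
  ... | inj₁ v◁c = ⊥-elim (◁⇒¬touch (◁-trans v◁c c◁u) (proj₁ (R⇒overlap ruv)))

  apart-◁-touching : ∀ {y x a} → Apart y a → y ◁ x → l x ≤ r a → y ◁ a
  apart-◁-touching y#a y◁x lx≤ra with apart⇒◁⊎▷ y#a
  ... | inj₁ y◁a = y◁a
  ... | inj₂ a◁y = ⊥-elim (◁⇒¬touch (◁-trans a◁y y◁x) lx≤ra)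

  apart-▷-touching : ∀ {y x b} → Apart y b → x ◁ y → l b ≤ r x → b ◁ y
  apart-▷-touching y#b x◁y lb≤rx with apart⇒◁⊎▷ y#b
  ... | inj₂ b◁y = b◁y
  ... | inj₁ y◁b = ⊥-elim (◁⇒¬touch (◁-trans x◁y y◁b) lb≤rx)

  private
    detours-from-the-left : ∀ {x y a b} → R x a → R x b → Apart x y → Apart y a → Apart y b →
                            a ◁ b → Walk a y b → Walk b y a → ⊥
    detours-from-the-left rxa rxb x#y y#a y#b a◁b y↝b y↝a with apart⇒◁⊎▷ x#y
    ... | inj₂ y◁x = ◁-asym a◁b (walk-◁ y↝b (apart-◁-touching y#a y◁x (proj₁ (R⇒overlap rxa))))
    ... | inj₁ x◁y = ◁-asym a◁b (walk-▷ y↝a (apart-▷-touching y#b x◁y (proj₂ (R⇒overlap rxb))))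

  no-mutual-detours : ∀ {x y a b} → R x a → R x b → Apart x y → Apart y a → Apart y b →
                      Apart a b → Walk a y b → Walk b y a → ⊥
  no-mutual-detours rxa rxb x#y y#a y#b a#b y↝b y↝a with apart⇒◁⊎▷ a#b
  ... | inj₁ a◁b = detours-from-the-left rxa rxb x#y y#a y#b a◁b y↝b y↝a
  ... | inj₂ b◁a = detours-from-the-left rxb rxa x#y y#b y#a b◁a y↝a y↝b

module IntervalGraph {n : ℕ} (G : Graph n) (l r : Fin n → ℚ)
  (valid : ∀ v → l v ≤ r v)
  (model : ∀ u v → u ≢ v → Adj G u v ⇔ (l u ≤ r v × l v ≤ r u)) where

  open IntervalModel (Adj G) l r valid model using (R⇒overlap)
  open DecTotalOrder ≤-decTotalOrder using (totalOrder)
  open import Data.List.Extrema totalOrder using (argmin; argmin-sel; f[argmin]≤f[xs])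

  Stabbed : ℚ → Fin n → Set
  Stabbed q w = l w ≤ q × q ≤ r w

  stabbed-isClique : ∀ q → IsClique G (Stabbed q)
  stabbed-isClique q u v (lu≤q , q≤ru) (lv≤q , q≤rv) u≢v =
    from (model u v u≢v) (≤-trans lu≤q q≤rv , ≤-trans lv≤q q≤ru)

  private
    -- The clique is stabbed at the smallest right endpoint reaching l v.
    edge-in-maximalClique-≤ : ∀ {u v} → Adj G u v → l u ≤ l v →
                              ∃ λ C → IsMaximalClique G C × C u × C v
    edge-in-maximalClique-≤ {u} {v} uv lu≤lv =
      Stabbed (r z) , (stabbed-isClique (r z) , maximal) , (≤-trans lu≤lv lv≤rz , rz≤ u lv≤ru) , v-stabbed
      where
      Reaching : Fin n → Set
      Reaching w = l v ≤ r w

      reaching? : ∀ w → Dec (Reaching w)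
      reaching? w = l v ≤? r w

      lv≤ru : Reaching u
      lv≤ru = proj₂ (R⇒overlap uv)

      candidates : List (Fin n)
      candidates = filter reaching? (allFin n)

      z : Fin n
      z = argmin r u candidates

      lv≤rz : Reaching z
      lv≤rz with argmin-sel r u candidates
      ... | inj₁ z≡u = subst Reaching (≡-sym z≡u) lv≤ru
      ... | inj₂ z∈  = proj₂ (∈-filter⁻ reaching? {xs = allFin n} z∈)

      rz≤ : ∀ w → Reaching w → r z ≤ r w
      rz≤ w reach = All.lookup (f[argmin]≤f[xs] u candidates) (∈-filter⁺ reaching? (∈-allFin w) reach)

      v-stabbed : Stabbed (r z) v
      v-stabbed = lv≤rz , rz≤ v (valid v)

      maximal : ∀ w → (∀ t → Stabbed (r z) t → t ≢ w → Adj G t w) → Stabbed (r z) w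
      maximal w adjAll with l w ≤? r z | r z ≤? r w
      ... | yes lw≤rz | yes rz≤rw = lw≤rz , rz≤rw
      ... | no lw≰rz | _ = ⊥-elim (lw≰rz (proj₂ (R⇒overlap (adjAll z (valid z , ≤-refl) z≢w))))
        where
        z≢w : z ≢ w
        z≢w refl = lw≰rz (valid z)
      ... | yes _ | no rz≰rw = ⊥-elim (rz≰rw (rz≤ w (proj₁ (R⇒overlap (adjAll v v-stabbed v≢w)))))
        where
        v≢w : v ≢ w
        v≢w refl = rz≰rw (rz≤ v (valid v))

  edge-in-maximalClique : ∀ {u v} → Adj G u v → ∃ λ C → IsMaximalClique G C × C u × C v
  edge-in-maximalClique {u} {v} uv with ≤-total (l u) (l v)
  ... | inj₁ lu≤lv = edge-in-maximalClique-≤ uv lu≤lv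
  ... | inj₂ lv≤lu =
    let C , maximalC , Cv , Cu = edge-in-maximalClique-≤ (Graph.sym G uv) lv≤lu in C , maximalC , Cu , Cv

module MPQTreeFacts {n : ℕ} (G : Graph n) (T : MPQ n)
  (node-unique : ∀ v a b → NodeOf T v a → NodeOf T v b → a ≡ b)
  (leaf-isMaximalClique : ∀ a → IsLeafAddr T a → IsMaximalClique G (OnPath T a))
  (maximalClique-leaf : ∀ C → IsMaximalClique G C →
                        Σ Addr λ a → IsLeafAddr T a × SameSet C (OnPath T a))
  (edge-in-maximalClique : ∀ {u v} → Adj G u v → ∃ λ C → IsMaximalClique G C × C u × C v)
  where

  Near : Fin n → Fin n → Set
  Near u w = u ≡ w ⊎ Adj G u w

  near-sym : ∀ {u w} → Near u w → Near w u
  near-sym (inj₁ u≡w) = inj₁ (≡-sym u≡w)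
  near-sym (inj₂ uw)  = inj₂ (Graph.sym G uw)

  OnPath-node : ∀ {v av L} → NodeOf T v av → OnPath T L v →
                ∃ λ b → L ≡ av ++ b × ∃ λ s → SubtreeAt T av s × Contributes s b v
  OnPath-node {v} {av} v-at path with OnPath⇒contributes path
  ... | a , b , L≡ , s , st , m with node-unique v a av (s , st , Contributes⇒Carries s m) v-at
  ... | refl = b , L≡ , s , st , m

  onLeaf⇒near : ∀ {L u w} → IsLeafAddr T L → OnPath T L u → OnPath T L w → Near u w
  onLeaf⇒near {L} {u} {w} leaf u-on w-on with u ≟ w
  ... | yes u≡w = inj₁ u≡w
  ... | no  u≢w = inj₂ (proj₁ (leaf-isMaximalClique L leaf) u w u-on w-on u≢w)

  near⇒onPath : ∀ {u w au} → NodeOf T u au → Near u w → ∃ λ L → OnPath T L u × OnPath T L w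
  near⇒onPath {au = au} u-at (inj₁ refl) = let e , _ , u-on = node-onLeaf u-at in au ++ e , u-on , u-on
  near⇒onPath {u} {w} _ (inj₂ uw) =
    let C , maximalC , Cu , Cw = edge-in-maximalClique uw
        L , _ , C≗L = maximalClique-leaf C maximalC
    in L , to (C≗L u) Cu , to (C≗L w) Cw

  common-extension : ∀ {u w au aw} → NodeOf T u au → NodeOf T w aw → Near u w →
                     ∃₂ λ bu bw → au ++ bu ≡ aw ++ bw × ∃ λ s → SubtreeAt T au s × Contributes s bu u
  common-extension u-at w-at near =
    let L , u-on , w-on = near⇒onPath u-at near
        bu , L≡u , su = OnPath-node u-at u-on
        bw , L≡w , _ = OnPath-node w-at w-on
    in bu , bw , trans (≡-sym L≡u) L≡w , su

  near⇒same-child : ∀ {P i j zu zw u w} → NodeOf T u (P ++ i ∷ zu) → NodeOf T w (P ++ j ∷ zw) →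
                    Near u w → i ≡ j
  near⇒same-child {P} {i} {j} {zu} {zw} u-at w-at near =
    let bu , bw , eq , _ = common-extension u-at w-at near
    in ∷-injectiveˡ (++-cancelˡ P _ _
         (trans (≡-sym (++-assoc P (i ∷ zu) bu)) (trans eq (++-assoc P (j ∷ zw) bw))))

  near⇒in-section : ∀ {P ss i S c d w z} → SubtreeAt T P (qnode ss) → Nth ss i (S , c) →
                    NodeOf T d P → NodeOf T w (P ++ i ∷ z) → Near d w → d ∈ S
  near⇒in-section {P} {i = i} {z = z} st p d-at w-at near with common-extension d-at w-at near
  ... | bd , bw , eq , s , sd , m
      with SubtreeAt-functional sd st | ++-cancelˡ P _ _ (trans eq (++-assoc P (i ∷ z) bw))
  ... | refl | refl with m
  ... | S' , c' , p' , d∈S' with Nth-functional p' p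
  ... | refl = d∈S'

  near⇒on-paths : ∀ {x w ax i z} → NodeOf T x ax → NodeOf T w (ax ++ i ∷ z) → Near x w →
                  ∀ z' → OnPath T (ax ++ i ∷ z') x
  near⇒on-paths {ax = ax} {i} {z} x-at w-at near with common-extension x-at w-at near
  ... | bx , bw , eq , s , sx , m with ++-cancelˡ ax _ _ (trans eq (++-assoc ax (i ∷ z) bw))
  ... | refl = λ z' → contributes⇒OnPath sx (Contributes-head s m)

  strictly-below-distinct : ∀ {x w ax i z} → NodeOf T x ax → NodeOf T w (ax ++ i ∷ z) → w ≢ x
  strictly-below-distinct {ax = ax} x-at w-at refl with ++-identityʳ-unique ax (node-unique _ _ _ x-at w-at)
  ... | ()

  on-paths⇒adjacent : ∀ {x w ax i z} → NodeOf T x ax → (∀ z' → OnPath T (ax ++ i ∷ z') x) →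
                      NodeOf T w (ax ++ i ∷ z) → Adj G x w
  on-paths⇒adjacent {x} {ax = ax} {i} {z} x-at x-on w-at with node-onLeaf w-at
  ... | e , leaf , w-on
      with onLeaf⇒near leaf (subst (λ L → OnPath T L x) (≡-sym (++-assoc ax (i ∷ z) e)) (x-on (z ++ e))) w-on
  ... | inj₁ x≡w = ⊥-elim (strictly-below-distinct x-at w-at (≡-sym x≡w))
  ... | inj₂ xw  = xw

  -- Sections are indexed 0 … k, and y lies below the central section suc j.
  module CentralSection
    {x y : Fin n} (xy : Adj G x y) {ax : Addr} (x-at : NodeOf T x ax)
    {q : ℕ} {q' : Addr} {ss : List (List (Fin n) × MPQ n)} (P-at : SubtreeAt T (ax ++ q ∷ q') (qnode ss))
    {S₁ Sk : List (Fin n)} {T₁ Tk : MPQ n} {k : ℕ} (length≡ : suc k ≡ length ss)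
    (first : Nth ss 0 (S₁ , T₁)) (last : Nth ss k (Sk , Tk))
    {a b : Fin n} {ra rb : Addr} (a-in : NodeOf T₁ a ra) (b-in : NodeOf Tk b rb)
    (condition-e : ∀ i A TA B TB C TC → Nth ss i (A , TA) → Nth ss (suc i) (B , TB) →
                   Nth ss (suc (suc i)) (C , TC) →
                   (Σ (Fin n) λ v → v ∈ B × v ∈ C × ¬ (v ∈ S₁)) ×
                   (Σ (Fin n) λ v → v ∈ A × v ∈ B × ¬ (v ∈ Sk)))
    {j : ℕ} {rj : Addr} (y-at : NodeOf T y ((ax ++ q ∷ q') ++ suc j ∷ rj)) (j+1<k : suc j ℕ.< k)
    {l r : Fin n → ℚ} (valid : ∀ v → l v ≤ r v)
    (model : ∀ u v → u ≢ v → removeEdge G x y u v ⇔ (l u ≤ r v × l v ≤ r u))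
    where

    P : Addr
    P = ax ++ q ∷ q'

    R : Fin n → Fin n → Set
    R = removeEdge G x y

    open IntervalModel R l r valid model

    below-P : ∀ {w z} → NodeOf T w (P ++ z) → NodeOf T w (ax ++ q ∷ (q' ++ z))
    below-P {w} {z} = subst (NodeOf T w) (++-assoc ax (q ∷ q') z)

    ≢x : ∀ {w z} → NodeOf T w (ax ++ q ∷ z) → w ≢ x
    ≢x = strictly-below-distinct x-at

    near⇒R : ∀ {u w} → u ≢ x → w ≢ x → Near u w → u ≡ w ⊎ R u w
    near⇒R _   _   (inj₁ u≡w) = inj₁ u≡w
    near⇒R u≢x w≢x (inj₂ uw)  = inj₂ (uw , λ { (inj₁ (u≡x , _)) → u≢x u≡x ; (inj₂ (_ , w≡x)) → w≢x w≡x })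

    apart : ∀ {u w} → ¬ Near u w → Apart u w
    apart ¬near (inj₁ u≡w)      = ¬near (inj₁ u≡w)
    apart ¬near (inj₂ (uw , _)) = ¬near (inj₂ uw)

    step : ∀ {c u v} → u ≢ x → v ≢ x → Near u v → Apart v c → Step c u v
    step u≢x v≢x near v#c = near⇒R u≢x v≢x near , v#c

    R-from-x : ∀ {w z} → NodeOf T w (P ++ z) → w ≢ y → R x w
    R-from-x w-at w≢y =
      on-paths⇒adjacent x-at x-on-paths (below-P w-at) ,
      λ { (inj₁ (_ , w≡y)) → w≢y w≡y ; (inj₂ (x≡y , _)) → ≢x (below-P y-at) (≡-sym x≡y) }
      where
      x-on-paths : ∀ z → OnPath T (ax ++ q ∷ z) x
      x-on-paths = near⇒on-paths x-at (below-P y-at) (inj₂ xy)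

    children-apart : ∀ {u w i i' zu zw} → NodeOf T u (P ++ i ∷ zu) → NodeOf T w (P ++ i' ∷ zw) →
                     i ≢ i' → Apart u w
    children-apart u-at w-at i≢i' = apart (λ near → i≢i' (near⇒same-child u-at w-at near))

    InSection : ℕ → Fin n → Set
    InSection i d = ∃₂ λ S c → Nth ss i (S , c) × d ∈ S

    MeetsChild : ℕ → Fin n → Set
    MeetsChild i w = ∃ λ e → IsLeafAddr T (P ++ i ∷ e) × OnPath T (P ++ i ∷ e) w

    section-node : ∀ {i d} → InSection i d → NodeOf T d P
    section-node {i} d∈ = qnode ss , P-at , Contributes⇒Carries (qnode ss) {i ∷ []} d∈

    section-≢x : ∀ {i d} → InSection i d → d ≢ x
    section-≢x d∈ = ≢x (section-node d∈)

    section-meets : ∀ {i d} → InSection i d → MeetsChild i d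
    section-meets d∈@(S , c , p , _) =
      let e , u , su , leaf = leaf-below c
      in e , IsLeafAddr-++ P-at (u , there (qc p) su , leaf) , contributes⇒OnPath P-at d∈

    node-meets : ∀ {w i z} → NodeOf T w (P ++ i ∷ z) → MeetsChild i w
    node-meets {w} {i} {z} w-at =
      let e , leaf , w-on = node-onLeaf w-at
      in z ++ e , subst (λ L → IsLeafAddr T L × OnPath T L w) (++-assoc P (i ∷ z) e) (leaf , w-on)

    meets⇒near : ∀ {i d w} → InSection i d → MeetsChild i w → Near w d
    meets⇒near d∈ (e , leaf , w-on) = onLeaf⇒near leaf w-on (contributes⇒OnPath P-at d∈)

    section-apart : ∀ {i i' S c d w z} → Nth ss i (S , c) → ¬ d ∈ S → InSection i' d →
                    NodeOf T w (P ++ i ∷ z) → Apart d w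
    section-apart p d∉S d∈ w-at = apart (λ near → d∉S (near⇒in-section P-at p (section-node d∈) w-at near))

    k≢0 : k ≢ 0
    k≢0 k≡0 = ℕ.<⇒≢ (ℕ.<-trans (s≤s z≤n) j+1<k) (≡-sym k≡0)

    a-at : NodeOf T a (P ++ 0 ∷ ra)
    a-at = NodeOf-child P-at (qc first) a-in

    b-at : NodeOf T b (P ++ k ∷ rb)
    b-at = NodeOf-child P-at (qc last) b-in

    a#b : Apart a b
    a#b = children-apart a-at b-at (λ 0≡k → k≢0 (≡-sym 0≡k))

    b#a : Apart b a
    b#a = children-apart b-at a-at k≢0

    section : ∀ i → i ℕ.≤ k → ∃₂ λ S c → Nth ss i (S , c)
    section i i≤k = let (S , c) , p = Nth-total ss (subst (i ℕ.<_) length≡ (s≤s i≤k)) in S , c , p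

    bridges : ∀ i → suc (suc i) ℕ.≤ k →
              (∃ λ d → InSection (suc i) d × InSection (suc (suc i)) d × ¬ d ∈ S₁) ×
              (∃ λ d → InSection i d × InSection (suc i) d × ¬ d ∈ Sk)
    bridges i ssi≤k =
      let A , TA , pA = section i (ℕ.<⇒≤ (ℕ.<⇒≤ ssi≤k))
          B , TB , pB = section (suc i) (ℕ.<⇒≤ ssi≤k)
          C , TC , pC = section (suc (suc i)) ssi≤k
          (d , d∈B , d∈C , d∉S₁) , (d' , d'∈A , d'∈B , d'∉Sk) = condition-e i A TA B TB C TC pA pB pC
      in (d , (B , TB , pB , d∈B) , (C , TC , pC , d∈C) , d∉S₁) ,
         (d' , (A , TA , pA , d'∈A) , (B , TB , pB , d'∈B) , d'∉Sk)

    mutual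
      forward : ∀ m i → suc (suc i) + m ≡ k → ∀ {w} → w ≢ x → MeetsChild (suc i) w → Walk a w b
      forward m i i+2+m≡k w≢x w-meets
          with proj₁ (bridges i (subst (suc (suc i) ℕ.≤_) i+2+m≡k (ℕ.m≤m+n (suc (suc i)) m)))
      ... | d , d∈ , d∈′ , d∉S₁ =
        step w≢x (section-≢x d∈) (meets⇒near d∈ w-meets) (section-apart first d∉S₁ d∈ a-at) ◅
        forward-from-section m (suc i) i+2+m≡k d∈′

      forward-from-section : ∀ m i → suc i + m ≡ k → ∀ {d} → InSection (suc i) d → Walk a d b
      forward-from-section zero i i+1≡k d∈ =
        step (section-≢x d∈) (≢x (below-P b-at)) (near-sym (meets⇒near d∈ b-meets)) b#a ◅ ε
        where
        b-meets : MeetsChild (suc i) b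
        b-meets = subst (λ t → MeetsChild t b) (trans (≡-sym i+1≡k) (ℕ.+-identityʳ (suc i))) (node-meets b-at)
      forward-from-section (suc m) i i+1+m≡k d∈ =
        forward m i (trans (≡-sym (ℕ.+-suc (suc i) m)) i+1+m≡k) (section-≢x d∈) (section-meets d∈)

    mutual
      backward : ∀ i → suc i ℕ.< k → ∀ {w} → w ≢ x → MeetsChild (suc i) w → Walk b w a
      backward i i+1<k w≢x w-meets with proj₂ (bridges i i+1<k)
      ... | d , d∈′ , d∈ , d∉Sk =
        step w≢x (section-≢x d∈) (meets⇒near d∈ w-meets) (section-apart last d∉Sk d∈ b-at) ◅
        backward-from-section i (ℕ.<⇒≤ i+1<k) d∈′

      backward-from-section : ∀ i → i ℕ.< k → ∀ {d} → InSection i d → Walk b d a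
      backward-from-section zero _ d∈ =
        step (section-≢x d∈) (≢x (below-P a-at)) (near-sym (meets⇒near d∈ (node-meets a-at))) a#b ◅ ε
      backward-from-section (suc i) i+1<k d∈ =
        backward i i+1<k (section-≢x d∈) (section-meets d∈)

    contradiction : ⊥
    contradiction =
      no-mutual-detours (R-from-x a-at (λ a≡y → y#a (inj₁ (≡-sym a≡y))))
                        (R-from-x b-at (λ b≡y → y#b (inj₁ (≡-sym b≡y))))
                        x#y y#a y#b a#b
                        (forward m j j+2+m≡k y≢x (node-meets y-at)) (backward j j+1<k y≢x (node-meets y-at))
      where
      y≢x : y ≢ x
      y≢x = ≢x (below-P y-at)

      x#y : Apart x y
      x#y (inj₁ x≡y)         = y≢x (≡-sym x≡y)
      x#y (inj₂ (_ , ¬edge)) = ¬edge (inj₁ (refl , refl))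

      y#a : Apart y a
      y#a = children-apart y-at a-at (λ ())

      y#b : Apart y b
      y#b = children-apart y-at b-at (ℕ.<⇒≢ j+1<k)

      m : ℕ
      m = proj₁ (ℕ.m≤n⇒∃[o]m+o≡n j+1<k)

      j+2+m≡k : suc (suc j) + m ≡ k
      j+2+m≡k = proj₂ (ℕ.m≤n⇒∃[o]m+o≡n j+1<k)

  through-central-section⇒¬intervalEdge :
    ∀ {x y ax q j rj ss} → Adj G x y → NodeOf T x ax → q ≢ [] →
    SubtreeAt T (ax ++ q) (qnode ss) → QNodeConditions ss →
    NodeOf T y ((ax ++ q) ++ j ∷ rj) → 0 ℕ.< j → suc j ℕ.< length ss → ¬ IsIntervalEdge G x y
  through-central-section⇒¬intervalEdge {q = []} _ _ q≢[] = ⊥-elim (q≢[] refl)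
  through-central-section⇒¬intervalEdge {q = _ ∷ _} {j = suc j} xy x-at _ P-at
      (_ , _ , _ , _ , k , length≡ , first , last , (_ , _ , a-in) , (_ , _ , b-in) , _ , _ , _ , condition-e)
      y-at _ j+2<length (_ , _ , valid , model) =
    CentralSection.contradiction xy x-at P-at length≡ first last a-in b-in condition-e y-at j+1<k valid model
    where
    j+1<k : suc j ℕ.< k
    j+1<k = ℕ.≤-pred (subst (suc (suc j) ℕ.<_) (≡-sym length≡) j+2<length)

lemma17 : ∀ {n : ℕ} (G : Graph n) → IsIntervalGraph G →
          (T : MPQ n) → IsMPQTree G T →
          (x y : Fin n) → Adj G x y →
          (ax ay : Addr) → NodeOf T x ax → NodeOf T y ay →
          IsPrefix ax ay → ax ≢ ay →
          ThroughCentral T ax ay →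
          ¬ IsIntervalEdge G x y
lemma17 G (l , r , valid , model) T (_ , node-unique , _ , leaf-clique , clique-leaf , _ , _ , qnode-conditions)
        x y xy ax ay x-at y-at _ _ (q , j , rj , ss , ay≡ , q≢[] , P-at , 0<j , j<length) =
  through-central-section⇒¬intervalEdge xy x-at q≢[] P-at (qnode-conditions _ ss P-at)
    (subst (NodeOf T y) (trans ay≡ (≡-sym (++-assoc ax q (j ∷ rj)))) y-at) 0<j j<length
  where
  open MPQTreeFacts G T node-unique leaf-clique clique-leaf
                    (IntervalGraph.edge-in-maximalClique G l r valid model)
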